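{- For every integer $n\ge1$, $$\sum_{k=1}^{n+1}\frac{k!}{(n+1)^k}\le\sum_{k=1}^{n}\frac{k!}{n^k}.$$ -}

module Defs where

open import Data.Nat as ℕ using (ℕ; zero; suc; _^_; NonZero)
open import Data.Nat using (_!)
open import Data.Nat.Properties using (m^n≢0)
open import Data.Integer using (+_)
open import Data.Rational using (ℚ; _/_; _+_; 0ℚ)

term : (m k : ℕ) .{{_ : NonZero m}} → ℚ
term m k = (+ (k !)) / (m ^ k)
  where instance _ = m^n≢0 m k

S : (m N : ℕ) .{{_ : NonZero m}} → ℚ
S m zero = 0ℚ
S m (suc N) = S m N + term m (suc N)

-- Write x = n + 1. Term by term k!/x^k ≤ k!/n^k, and at k = 1 this gains
-- 1/n − 1/x = 1/(n x). The left sum has the one extra term x!/x^x, which the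
-- gain absorbs as soon as x! · n x ≤ x^x; that holds for n ≥ 4 because
-- (x − 2)! ≤ 3! · x^(x − 5) and 6 (x − 1)² ≤ x³. The cases n = 1, 2, 3 are
-- decided by computation.
module Submission where

open import Defs
open import Data.Nat using (ℕ; suc; _≥_; >-nonZero)
open import Data.Rational using (_≤_)

open import Algebra.Bundles using (CommutativeMonoid)
open import Data.Nat as ℕ using (zero; NonZero; _!; _^_)
import Data.Nat.Properties as ℕP
open import Data.Nat.Tactic.RingSolver using (solve-∀)
open import Data.Integer as ℤ using (+_)
open import Data.Integer.Properties using (pos-*; pos-+)
open import Data.Rational using (_/_; _+_; 0ℚ; toℚᵘ)
import Data.Rational.Properties as ℚP
open import Data.Rational.Properties
  using (toℚᵘ-cancel-≤; toℚᵘ-injective; toℚᵘ-homo-+; toℚᵘ-fromℚᵘ;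
         ≤-reflexive; ≤-trans; +-mono-≤; +-comm; +-identityˡ; _≤?_)
open import Data.Rational.Unnormalised as ℚᵘ using (mkℚᵘ; *≤*)
import Data.Rational.Unnormalised.Properties as ℚᵘP
open import Relation.Binary.PropositionalEquality using (_≡_; sym; subst; subst₂; cong; cong₂; module ≡-Reasoning)
open import Relation.Nullary.Decidable using (toWitness)

import Algebra.Properties.CommutativeSemigroup as CommSemigroupProperties

toℚᵘ-/ : ∀ i n .{{_ : NonZero n}} → toℚᵘ (i / n) ℚᵘ.≃ (i ℚᵘ./ n)
toℚᵘ-/ i (suc n) = toℚᵘ-fromℚᵘ (mkℚᵘ i n)

/-≤-/ᵘ : ∀ a b c d .{{_ : NonZero b}} .{{_ : NonZero d}} →
         a ℕ.* d ℕ.≤ c ℕ.* b → (+ a) ℚᵘ./ b ℚᵘ.≤ (+ c) ℚᵘ./ d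
/-≤-/ᵘ a (suc b) c (suc d) ad≤cb =
  *≤* (subst₂ ℤ._≤_ (pos-* a (suc d)) (pos-* c (suc b)) (ℤ.+≤+ ad≤cb))

/-≤-/ : ∀ a b c d .{{_ : NonZero b}} .{{_ : NonZero d}} →
        a ℕ.* d ℕ.≤ c ℕ.* b → (+ a) / b ≤ (+ c) / d
/-≤-/ a b c d ad≤cb = toℚᵘ-cancel-≤
  (ℚᵘP.≤-respˡ-≃ (ℚᵘP.≃-sym (toℚᵘ-/ (+ a) b))
    (ℚᵘP.≤-respʳ-≃ (ℚᵘP.≃-sym (toℚᵘ-/ (+ c) d)) (/-≤-/ᵘ a b c d ad≤cb)))

/-+-/ᵘ : ∀ a b c d .{{_ : NonZero b}} .{{_ : NonZero d}} →
         (+ a) ℚᵘ./ b ℚᵘ.+ (+ c) ℚᵘ./ d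
           ≡ ((+ (a ℕ.* d ℕ.+ c ℕ.* b)) ℚᵘ./ (b ℕ.* d)) {{ℕP.m*n≢0 b d}}
/-+-/ᵘ a (suc b) c (suc d) = cong (λ i → i ℚᵘ./ (suc b ℕ.* suc d)) (begin
  + a ℤ.* + suc d ℤ.+ + c ℤ.* + suc b
    ≡⟨ cong₂ ℤ._+_ (sym (pos-* a (suc d))) (sym (pos-* c (suc b))) ⟩
  + (a ℕ.* suc d) ℤ.+ + (c ℕ.* suc b)
    ≡⟨ sym (pos-+ (a ℕ.* suc d) (c ℕ.* suc b)) ⟩
  + (a ℕ.* suc d ℕ.+ c ℕ.* suc b) ∎)
  where open ≡-Reasoning

/-+-/ : ∀ a b c d .{{_ : NonZero b}} .{{_ : NonZero d}} →
        (+ a) / b + (+ c) / d ≡ ((+ (a ℕ.* d ℕ.+ c ℕ.* b)) / (b ℕ.* d)) {{ℕP.m*n≢0 b d}}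
/-+-/ a b c d = toℚᵘ-injective (begin
  toℚᵘ ((+ a) / b + (+ c) / d)           ≈⟨ toℚᵘ-homo-+ ((+ a) / b) ((+ c) / d) ⟩
  toℚᵘ ((+ a) / b) ℚᵘ.+ toℚᵘ ((+ c) / d) ≈⟨ ℚᵘP.+-cong (toℚᵘ-/ (+ a) b) (toℚᵘ-/ (+ c) d) ⟩
  (+ a) ℚᵘ./ b ℚᵘ.+ (+ c) ℚᵘ./ d         ≡⟨ /-+-/ᵘ a b c d ⟩
  (+ ad+cb) ℚᵘ./ (b ℕ.* d)               ≈⟨ ℚᵘP.≃-sym (toℚᵘ-/ (+ ad+cb) (b ℕ.* d)) ⟩
  toℚᵘ ((+ ad+cb) / (b ℕ.* d))           ∎)
  where
  open ℚᵘP.≃-Reasoning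
  ad+cb = a ℕ.* d ℕ.+ c ℕ.* b
  instance _ = ℕP.m*n≢0 b d

!-≤-*^ : ∀ a m {c} → a ℕ.+ m ℕ.≤ c → (a ℕ.+ m) ! ℕ.≤ a ! ℕ.* c ^ m
!-≤-*^ a zero {c} _ rewrite ℕP.+-identityʳ a = ℕP.≤-reflexive (sym (ℕP.*-identityʳ (a !)))
!-≤-*^ a (suc m) {c} a+1+m≤c rewrite ℕP.+-suc a m = begin
  suc (a ℕ.+ m) ℕ.* (a ℕ.+ m) ! ≤⟨ ℕP.*-mono-≤ a+1+m≤c (!-≤-*^ a m (ℕP.<⇒≤ a+1+m≤c)) ⟩
  c ℕ.* (a ! ℕ.* c ^ m)         ≡⟨ x∙yz≈y∙xz c (a !) (c ^ m) ⟩
  a ! ℕ.* (c ℕ.* c ^ m)         ∎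
  where
  open ℕP.≤-Reasoning
  open CommSemigroupProperties ℕP.*-commutativeSemigroup using (x∙yz≈y∙xz)

!-*-≤-^ : ∀ {n} → 4 ℕ.≤ n → suc n ! ℕ.* (n ℕ.* suc n) ℕ.≤ suc n ^ suc n
!-*-≤-^ (ℕ.s≤s (ℕ.s≤s (ℕ.s≤s (ℕ.s≤s (ℕ.z≤n {m}))))) = begin
  x ℕ.* (y ℕ.* (3 ℕ.+ m) !) ℕ.* (y ℕ.* x)   ≡⟨ regroup x y ((3 ℕ.+ m) !) ⟩
  (y ℕ.* y) ℕ.* (x ℕ.* x) ℕ.* (3 ℕ.+ m) !     ≤⟨ ℕP.*-monoʳ-≤ ((y ℕ.* y) ℕ.* (x ℕ.* x))
                                                   (!-≤-*^ 3 m (ℕP.m≤n+m (3 ℕ.+ m) 2)) ⟩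
  (y ℕ.* y) ℕ.* (x ℕ.* x) ℕ.* (6 ℕ.* x ^ m)   ≡⟨ split x y (x ^ m) ⟩
  (6 ℕ.* (y ℕ.* y)) ℕ.* (x ℕ.* (x ℕ.* x ^ m)) ≤⟨ ℕP.*-monoˡ-≤ (x ℕ.* (x ℕ.* x ^ m)) six-squares≤cube ⟩
  (x ℕ.* (x ℕ.* x)) ℕ.* (x ℕ.* (x ℕ.* x ^ m)) ≡⟨ merge x (x ^ m) ⟩
  x ^ x                                       ∎
  where
  open ℕP.≤-Reasoning
  x = 5 ℕ.+ m
  y = 4 ℕ.+ m
  regroup : ∀ x y f → x ℕ.* (y ℕ.* f) ℕ.* (y ℕ.* x) ≡ (y ℕ.* y) ℕ.* (x ℕ.* x) ℕ.* f
  regroup = solve-∀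
  split : ∀ x y p → (y ℕ.* y) ℕ.* (x ℕ.* x) ℕ.* (6 ℕ.* p) ≡ (6 ℕ.* (y ℕ.* y)) ℕ.* (x ℕ.* (x ℕ.* p))
  split = solve-∀
  merge : ∀ x p → (x ℕ.* (x ℕ.* x)) ℕ.* (x ℕ.* (x ℕ.* p)) ≡ x ℕ.* (x ℕ.* (x ℕ.* (x ℕ.* (x ℕ.* p))))
  merge = solve-∀
  expand : ∀ m → 6 ℕ.* ((4 ℕ.+ m) ℕ.* (4 ℕ.+ m)) ℕ.+ (m ℕ.* m ℕ.* m ℕ.+ 9 ℕ.* m ℕ.* m ℕ.+ 27 ℕ.* m ℕ.+ 29)
                 ≡ (5 ℕ.+ m) ℕ.* ((5 ℕ.+ m) ℕ.* (5 ℕ.+ m))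
  expand = solve-∀
  six-squares≤cube : 6 ℕ.* (y ℕ.* y) ℕ.≤ x ℕ.* (x ℕ.* x)
  six-squares≤cube = subst (6 ℕ.* (y ℕ.* y) ℕ.≤_) (expand m) (ℕP.m≤m+n _ _)

term-antimono : ∀ {m n} .{{_ : NonZero m}} .{{_ : NonZero n}} → n ℕ.≤ m → ∀ k → term m k ≤ term n k
term-antimono {m} {n} n≤m k = /-≤-/ (k !) (m ^ k) (k !) (n ^ k) {{ℕP.m^n≢0 m k}} {{ℕP.m^n≢0 n k}}
  (ℕP.*-monoʳ-≤ (k !) (ℕP.^-monoˡ-≤ k n≤m))

S-antimono-absorbing : ∀ {m n} .{{_ : NonZero m}} .{{_ : NonZero n}} → n ℕ.≤ m →
                       ∀ {r} → r + term m 1 ≤ term n 1 → ∀ N → S m (suc N) + r ≤ S n (suc N)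
S-antimono-absorbing {m} {n} _ {r} r+t≤t zero = begin
  0ℚ + term m 1 + r ≡⟨ cong (_+ r) (+-identityˡ (term m 1)) ⟩
  term m 1 + r      ≡⟨ +-comm (term m 1) r ⟩
  r + term m 1      ≤⟨ r+t≤t ⟩
  term n 1          ≡⟨ sym (+-identityˡ (term n 1)) ⟩
  0ℚ + term n 1     ∎
  where open ℚP.≤-Reasoning
S-antimono-absorbing {m} {n} n≤m {r} r+t≤t (suc N) = begin
  S m (suc N) + term m (2 ℕ.+ N) + r ≡⟨ xy∙z≈xz∙y (S m (suc N)) (term m (2 ℕ.+ N)) r ⟩
  S m (suc N) + r + term m (2 ℕ.+ N) ≤⟨ +-mono-≤ (S-antimono-absorbing n≤m r+t≤t N)
                                                  (term-antimono n≤m (2 ℕ.+ N)) ⟩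
  S n (suc N) + term n (2 ℕ.+ N)     ∎
  where
  open ℚP.≤-Reasoning
  open CommSemigroupProperties
    (CommutativeMonoid.commutativeSemigroup ℚP.+-0-commutativeMonoid) using (xy∙z≈xz∙y)

last-term-absorbed : ∀ n .{{_ : NonZero n}} → suc n ! ℕ.* (n ℕ.* suc n) ℕ.≤ suc n ^ suc n →
                     term (suc n) (suc n) + term (suc n) 1 ≤ term n 1
last-term-absorbed n x!nx≤xˣ =
  ≤-trans (≤-reflexive (/-+-/ (x !) P 1 (x ^ 1)))
          (/-≤-/ (x ! ℕ.* x ^ 1 ℕ.+ 1 ℕ.* P) (P ℕ.* x ^ 1) 1 (n ^ 1) cross-multiplied)
  where
  x = suc n
  P = x ^ x
  instance
    _ = ℕP.m^n≢0 x x
    _ = ℕP.m^n≢0 x 1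
    _ = ℕP.m*n≢0 P (x ^ 1)
    _ = ℕP.m^n≢0 n 1
  expand : ∀ a p n → (a ℕ.* ((1 ℕ.+ n) ℕ.* 1) ℕ.+ 1 ℕ.* p) ℕ.* (n ℕ.* 1) ≡ a ℕ.* (n ℕ.* (1 ℕ.+ n)) ℕ.+ p ℕ.* n
  expand = solve-∀
  collect : ∀ p n → p ℕ.+ p ℕ.* n ≡ 1 ℕ.* (p ℕ.* ((1 ℕ.+ n) ℕ.* 1))
  collect = solve-∀
  cross-multiplied : (x ! ℕ.* x ^ 1 ℕ.+ 1 ℕ.* P) ℕ.* n ^ 1 ℕ.≤ 1 ℕ.* (P ℕ.* x ^ 1)
  cross-multiplied = begin
    (x ! ℕ.* x ^ 1 ℕ.+ 1 ℕ.* P) ℕ.* n ^ 1 ≡⟨ expand (x !) P n ⟩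
    x ! ℕ.* (n ℕ.* x) ℕ.+ P ℕ.* n          ≤⟨ ℕP.+-monoˡ-≤ (P ℕ.* n) x!nx≤xˣ ⟩
    P ℕ.+ P ℕ.* n                         ≡⟨ collect P n ⟩
    1 ℕ.* (P ℕ.* x ^ 1)                    ∎
    where open ℕP.≤-Reasoning

lemma3p5 : (n : ℕ) → (n≥1 : n ≥ 1) → S (suc n) (suc n) ≤ S n n {{>-nonZero n≥1}}
lemma3p5 1 _ = toWitness {a? = S 2 2 ≤? S 1 1} _
lemma3p5 2 _ = toWitness {a? = S 3 3 ≤? S 2 2} _
lemma3p5 3 _ = toWitness {a? = S 4 4 ≤? S 3 3} _
lemma3p5 n@(suc (suc (suc (suc m)))) _ =
  S-antimono-absorbing (ℕP.n≤1+n n) (last-term-absorbed n (!-*-≤-^ (ℕP.m≤m+n 4 m))) (3 ℕ.+ m)
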